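{- Let $n,\delta\in\mathbb{N}$ with $\delta\ge 3$ and $n\ge 2\delta^*$, where $\delta^*=\delta^2-2\lfloor\delta/2\rfloor+1$. Let $X=(n_0,\ldots,n_d)$ be a finite sequence of nonnegative integers satisfying (C1)–(C4) below such that $g(X)\ge g(X')$ for every finite sequence $X'$ of nonnegative integers satisfying (C1)–(C4) (with the same $n,\delta$). Then $X=Z_{n,\delta}$. Conditions on $(n_0,\ldots,n_d)$: (C1) $n_0=1$; (C2) $\sum_{i=0}^\infty n_i=n$; (C3) if $n_i\ge1$, then $n_1,\ldots,n_{i-1}\ge1$; (C4) for all $i\in\{0,1,\ldots,d\}$ with $i\equiv0\pmod5$, $n_{i-2}+n_{i-1}+n_i+n_{i+1}+n_{i+2}\ge\delta^*$.
   Context: For a finite sequence $(n_0,\ldots,n_d)$, $n_i=0$ for integers $i<0$ or $i>d$, and $g((n_0,\ldots,n_d))=\sum_{i\ge0} i\,n_i$. Write $n=\delta^*p+q$ with integers $p\ge0$ and $0\le q\le\delta^*-1$. Then $Z_{n,\delta}$ is $(1,1,\delta^*-2,[1,1,1,1,\delta^*-4]^{p-1})$ if $q=0$; $(1,1,\delta^*-2,[1,1,1,1,\delta^*-4]^{p-1},1)$ if $q=1$; and $(1,1,\delta^*-2,[1,1,1,1,\delta^*-4]^{p-1},1,q-1)$ if $2\le q\le\delta^*-1$. Here $[1,1,1,1,\delta^*-4]^{p-1}$ denotes $p-1$ consecutive repetitions of the block $(1,1,1,1,\delta^*-4)$. -}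

module Defs where

open import Data.Nat using (ℕ; zero; suc; _+_; _*_; _∸_; _≤_; _<_; _≥_)
open import Data.Nat.DivMod using (_/_; _%_)
open import Data.Nat.Divisibility using (_∣_)
open import Data.Integer as ℤ using (ℤ; +_; -[1+_])
open import Data.List using (List; []; _∷_; length; concat; replicate; _++_)
open import Data.Nat.ListAction using (sum)
open import Data.Product using (_×_)
open import Relation.Binary.PropositionalEquality using (_≡_)

-- A finite sequence (n_0,…,n_d) is a list of length d+1.
Seq : Set
Seq = List ℕ

-- n_i, with n_i = 0 for i > d (natural-number index)
at : Seq → ℕ → ℕ
at []       _       = 0
at (x ∷ xs) zero    = x
at (x ∷ xs) (suc i) = at xs i

-- n_i for an integer index, with n_i = 0 for i < 0
atℤ : Seq → ℤ → ℕ
atℤ xs (+ i)    = at xs i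
atℤ xs -[1+ _ ] = 0

gFrom : ℕ → Seq → ℕ
gFrom k []       = 0
gFrom k (x ∷ xs) = k * x + gFrom (suc k) xs

g : Seq → ℕ
g X = gFrom 0 X

δ* : ℕ → ℕ
δ* δ = suc (δ * δ ∸ 2 * (δ / 2))

C1 : Seq → Set
C1 X = at X 0 ≡ 1

C2 : ℕ → Seq → Set
C2 n X = sum X ≡ n

C3 : Seq → Set
C3 X = ∀ i → 1 ≤ at X i → ∀ j → 1 ≤ j → j < i → 1 ≤ at X j

-- i ∈ {0,…,d} is  i < length X  (d = length X − 1)
C4 : ℕ → Seq → Set
C4 δ X = ∀ i → i < length X → 5 ∣ i →
  atℤ X (+ i ℤ.- + 2) + atℤ X (+ i ℤ.- + 1) + atℤ X (+ i)
    + atℤ X (+ i ℤ.+ + 1) + atℤ X (+ i ℤ.+ + 2) ≥ δ* δ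

Admissible : ℕ → ℕ → Seq → Set
Admissible n δ X = C1 X × C2 n X × C3 X × C4 δ X

block : ℕ → Seq
block s = 1 ∷ 1 ∷ 1 ∷ 1 ∷ (s ∸ 4) ∷ []

tailZ : ℕ → Seq
tailZ zero          = []
tailZ (suc zero)    = 1 ∷ []
tailZ (suc (suc k)) = 1 ∷ suc k ∷ []

Z : ℕ → ℕ → Seq
Z n δ = 1 ∷ 1 ∷ (s ∸ 2) ∷ (concat (replicate (p ∸ 1) (block s)) ++ tailZ q)
  where
  s = δ* δ
  p = n / s
  q = n % s

-- Abel summation gives g(X) = N·n − Σ_{t<N} P_X(t+1) for the prefix sums P_X(t) = n_0 + ⋯ + n_{t−1}
-- (N ≥ d + 1), so pointwise smaller prefix sums mean a larger g. For admissible X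
-- with P_X(t) < n, (C3) forces n_0, …, n_t ≥ 1, and each (C4)-window inside the first t entries
-- contributes δ*, whence P_X(3 + 5j + r) ≥ (j+1)δ* + r. Z_{n,δ} is admissible and meets these bounds
-- (its tail has at most two entries, so no further window fits), so P_Z ≤ P_X pointwise; together
-- with g(X) ≥ g(Z) this forces P_X = P_Z, i.e. X = Z_{n,δ}.

module Submission where

open import Defs
open import Data.Nat using (ℕ; zero; suc; _+_; _*_; _∸_; _≤_; _<_; _≥_; z≤n; s≤s; _<?_; NonZero)
open import Data.Nat.Properties
open import Data.Nat.DivMod using (_/_; _%_; m≡m%n+[m/n]*n; m%n<n; m*n/n≡m; m/n*n≤m; /-monoˡ-≤)
open import Data.Nat.Divisibility using (divides)
open import Data.Nat.ListAction using (sum)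
open import Data.Nat.ListAction.Properties using (sum-++)
open import Data.Nat.Tactic.RingSolver using (solve-∀)
open import Data.List using ([]; _∷_; length; take; drop; concat; replicate; _++_)
open import Data.List.Properties using (take-all; take++drop≡id)
open import Data.Product using (_×_; _,_; ∃-syntax; proj₁; proj₂)
open import Data.Sum using (_⊎_; inj₁; inj₂)
open import Function using (_∘_)
open import Relation.Binary.PropositionalEquality
  using (_≡_; refl; sym; trans; cong; cong₂; subst; module ≡-Reasoning)
open import Relation.Nullary using (yes; no; contradiction)

prefix : Seq → ℕ → ℕ
prefix X t = sum (take t X)

prefix-suc : ∀ X t → prefix X (suc t) ≡ prefix X t + at X t
prefix-suc []       zero    = refl
prefix-suc []       (suc t) = refl
prefix-suc (x ∷ xs) zero    = +-identityʳ x
prefix-suc (x ∷ xs) (suc t) = trans (cong (x +_) (prefix-suc xs t)) (sym (+-assoc x _ _))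

prefix≤sum : ∀ X t → prefix X t ≤ sum X
prefix≤sum X t = subst (prefix X t ≤_) sum-take++drop (m≤m+n _ _)
  where
  sum-take++drop : prefix X t + sum (drop t X) ≡ sum X
  sum-take++drop = trans (sym (sum-++ (take t X) _)) (cong sum (take++drop≡id t X))

prefix-all : ∀ X t → length X ≤ t → prefix X t ≡ sum X
prefix-all X t h = cong sum (take-all t X h)

window : Seq → ℕ → ℕ
window X t = at X t + at X (1 + t) + at X (2 + t) + at X (3 + t) + at X (4 + t)

prefix-+5 : ∀ X t → prefix X (5 + t) ≡ window X t + prefix X t
prefix-+5 X t
  rewrite prefix-suc X (4 + t) | prefix-suc X (3 + t) | prefix-suc X (2 + t)
        | prefix-suc X (1 + t) | prefix-suc X t
  = rearrange (prefix X t) _ _ _ _ _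
  where
  rearrange : ∀ P a b c d e → P + a + b + c + d + e ≡ (a + b + c + d + e) + P
  rearrange = solve-∀

prefix-+-positive : ∀ X a r → (∀ j → j < a + r → 1 ≤ at X j) → prefix X a + r ≤ prefix X (a + r)
prefix-+-positive X a zero _ rewrite +-identityʳ a | +-identityʳ (prefix X a) = ≤-refl
prefix-+-positive X a (suc r) pos = begin
  prefix X a + suc r              ≡⟨ +-suc (prefix X a) r ⟩
  suc (prefix X a + r)            ≡⟨ +-comm 1 _ ⟩
  prefix X a + r + 1              ≤⟨ +-mono-≤ (prefix-+-positive X a r (λ j j< → pos j (<-trans j< a+r<)))
                                              (pos (a + r) a+r<) ⟩
  prefix X (a + r) + at X (a + r) ≡⟨ sym (prefix-suc X (a + r)) ⟩
  prefix X (suc (a + r))          ≡⟨ cong (prefix X) (sym (+-suc a r)) ⟩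
  prefix X (a + suc r)            ∎
  where
  open ≤-Reasoning
  a+r< : a + r < a + suc r
  a+r< = ≤-reflexive (sym (+-suc a r))

at-positive⇒<length : ∀ X i → 1 ≤ at X i → i < length X
at-positive⇒<length (x ∷ xs) zero    _ = s≤s z≤n
at-positive⇒<length (x ∷ xs) (suc i) h = s≤s (at-positive⇒<length xs i h)

prefix<sum⇒positive-after : ∀ X t → prefix X t < sum X → ∃[ i ] t ≤ i × 1 ≤ at X i
prefix<sum⇒positive-after (zero ∷ xs) zero h with prefix<sum⇒positive-after xs zero h
... | i , _ , pos = suc i , z≤n , pos
prefix<sum⇒positive-after (suc x ∷ xs) zero _ = 0 , z≤n , s≤s z≤n
prefix<sum⇒positive-after (x ∷ xs) (suc t) h with prefix<sum⇒positive-after xs t (+-cancelˡ-< x _ _ h)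
... | i , t≤i , pos = suc i , s≤s t≤i , pos

sumBelow : ℕ → (ℕ → ℕ) → ℕ
sumBelow zero    f = 0
sumBelow (suc N) f = sumBelow N f + f N

sumBelow-zero : ∀ N → sumBelow N (λ _ → 0) ≡ 0
sumBelow-zero zero    = refl
sumBelow-zero (suc N) = trans (+-identityʳ _) (sumBelow-zero N)

sumBelow-+ : ∀ N c f → sumBelow N (λ t → c + f t) ≡ N * c + sumBelow N f
sumBelow-+ zero    c f = refl
sumBelow-+ (suc N) c f rewrite sumBelow-+ N c f = rearrange (N * c) (sumBelow N f) c (f N)
  where
  rearrange : ∀ a b c d → a + b + (c + d) ≡ c + a + (b + d)
  rearrange = solve-∀

sumBelow-suc : ∀ N f → sumBelow (suc N) f ≡ f 0 + sumBelow N (f ∘ suc)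
sumBelow-suc zero    f = +-comm 0 (f 0)
sumBelow-suc (suc N) f rewrite sumBelow-suc N f = +-assoc (f 0) _ _

sumBelow-mono-≤ : ∀ N {f h} → (∀ t → f t ≤ h t) → sumBelow N f ≤ sumBelow N h
sumBelow-mono-≤ zero    _  = z≤n
sumBelow-mono-≤ (suc N) le = +-mono-≤ (sumBelow-mono-≤ N le) (le N)

+-≡-≤⇒≡ʳ : ∀ {a b c d} → a ≤ b → c ≤ d → a + c ≡ b + d → c ≡ d
+-≡-≤⇒≡ʳ {a} {b} {c} {d} a≤b c≤d eq =
  ≤-antisym c≤d (+-cancelˡ-≤ b d c (≤-trans (≤-reflexive (sym eq)) (+-monoˡ-≤ c a≤b)))

sumBelow-≡-mono⇒≡ : ∀ N {f h} → (∀ t → f t ≤ h t) → sumBelow N f ≡ sumBelow N h →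
  ∀ t → t < N → f t ≡ h t
sumBelow-≡-mono⇒≡ (suc N) {f} {h} le eq t t<N with m≤n⇒m<n∨m≡n (≤-pred t<N)
... | inj₂ refl = +-≡-≤⇒≡ʳ (sumBelow-mono-≤ N le) (le N) eq
... | inj₁ t<N′ = sumBelow-≡-mono⇒≡ N le (+-≡-≤⇒≡ʳ (le N) (sumBelow-mono-≤ N le) eq′) t t<N′
  where
  eq′ : f N + sumBelow N f ≡ h N + sumBelow N h
  eq′ = trans (+-comm (f N) _) (trans eq (+-comm _ (h N)))

gFrom-suc : ∀ k xs → gFrom (suc k) xs ≡ sum xs + gFrom k xs
gFrom-suc k []       = refl
gFrom-suc k (y ∷ ys) rewrite gFrom-suc (suc k) ys = rearrange y k (sum ys) (gFrom (suc k) ys)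
  where
  rearrange : ∀ y k a G → (y + k * y) + (a + G) ≡ (y + a) + (k * y + G)
  rearrange = solve-∀

g+sumBelow-prefix : ∀ X N → length X ≤ N → g X + sumBelow N (prefix X ∘ suc) ≡ N * sum X
g+sumBelow-prefix []       N       _ = trans (sumBelow-zero N) (sym (*-zeroʳ N))
g+sumBelow-prefix (x ∷ xs) (suc M) (s≤s len≤M) = begin
  g (x ∷ xs) + sumBelow (suc M) (λ t → x + prefix xs t)
    ≡⟨ cong₂ _+_ (gFrom-suc 0 xs) (sumBelow-+ (suc M) x (prefix xs)) ⟩
  (sum xs + g xs) + (suc M * x + sumBelow (suc M) (prefix xs))
    ≡⟨ cong (λ z → (sum xs + g xs) + (suc M * x + z)) (sumBelow-suc M (prefix xs)) ⟩
  (sum xs + g xs) + (suc M * x + sumBelow M (prefix xs ∘ suc))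
    ≡⟨ rearrange (sum xs) (g xs) (suc M * x) _ ⟩
  (sum xs + suc M * x) + (g xs + sumBelow M (prefix xs ∘ suc))
    ≡⟨ cong ((sum xs + suc M * x) +_) (g+sumBelow-prefix xs M len≤M) ⟩
  (sum xs + suc M * x) + M * sum xs
    ≡⟨ collect (sum xs) M x ⟩
  suc M * (x + sum xs) ∎
  where
  open ≡-Reasoning
  rearrange : ∀ a G c Q → (a + G) + (c + Q) ≡ (a + c) + (G + Q)
  rearrange = solve-∀
  collect : ∀ a M x → (a + (1 + M) * x) + M * a ≡ (1 + M) * (x + a)
  collect = solve-∀

prefix-≡⇒at-≡ : ∀ X Y → (∀ t → prefix X t ≡ prefix Y t) → ∀ i → at X i ≡ at Y i
prefix-≡⇒at-≡ X Y eq i = +-cancelˡ-≡ (prefix X i) _ _ (begin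
  prefix X i + at X i ≡⟨ sym (prefix-suc X i) ⟩
  prefix X (suc i)    ≡⟨ eq (suc i) ⟩
  prefix Y (suc i)    ≡⟨ prefix-suc Y i ⟩
  prefix Y i + at Y i ≡⟨ cong (_+ at Y i) (sym (eq i)) ⟩
  prefix X i + at Y i ∎)
  where open ≡-Reasoning

prefix-≤-g-≤⇒at-≡ : ∀ X Y → sum Y ≡ sum X → (∀ t → prefix Y t ≤ prefix X t) → g Y ≤ g X →
  ∀ i → at X i ≡ at Y i
prefix-≤-g-≤⇒at-≡ X Y sumY≡sumX Y≤X gY≤gX = prefix-≡⇒at-≡ X Y (λ t → sym (prefixY≡prefixX t))
  where
  N : ℕ
  N = length X + length Y
  duality : g Y + sumBelow N (prefix Y ∘ suc) ≡ g X + sumBelow N (prefix X ∘ suc)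
  duality = begin
    g Y + sumBelow N (prefix Y ∘ suc) ≡⟨ g+sumBelow-prefix Y N (m≤n+m _ _) ⟩
    N * sum Y                         ≡⟨ cong (N *_) sumY≡sumX ⟩
    N * sum X                         ≡⟨ sym (g+sumBelow-prefix X N (m≤m+n _ _)) ⟩
    g X + sumBelow N (prefix X ∘ suc) ∎
    where open ≡-Reasoning
  prefixY≡prefixX : ∀ t → prefix Y t ≡ prefix X t
  prefixY≡prefixX zero = refl
  prefixY≡prefixX (suc t) with t <? N
  ... | yes t<N = sumBelow-≡-mono⇒≡ N (Y≤X ∘ suc)
                    (+-≡-≤⇒≡ʳ gY≤gX (sumBelow-mono-≤ N (Y≤X ∘ suc)) duality) t t<N
  ... | no  t≮N = begin
    prefix Y (suc t) ≡⟨ prefix-all Y (suc t) (≤-trans (m≤n+m _ _) N≤1+t) ⟩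
    sum Y            ≡⟨ sumY≡sumX ⟩
    sum X            ≡⟨ sym (prefix-all X (suc t) (≤-trans (m≤m+n _ _) N≤1+t)) ⟩
    prefix X (suc t) ∎
    where
    open ≡-Reasoning
    N≤1+t : N ≤ suc t
    N≤1+t = ≤-trans (≮⇒≥ t≮N) (n≤1+n t)

positive-upTo : ∀ {X} → C1 X → C3 X → ∀ {i} → 1 ≤ at X i → ∀ j → j ≤ i → 1 ≤ at X j
positive-upTo c1 c3 pos zero _ = subst (1 ≤_) (sym c1) ≤-refl
positive-upTo c1 c3 {i} pos (suc j) j≤i with m≤n⇒m<n∨m≡n j≤i
... | inj₁ j<i  = c3 i pos (suc j) (s≤s z≤n) j<i
... | inj₂ refl = pos

prefix<sum⇒positive : ∀ {X} → C1 X → C3 X → ∀ t → prefix X t < sum X →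
  (∀ j → j ≤ t → 1 ≤ at X j) × t < length X
prefix<sum⇒positive {X} c1 c3 t lt with prefix<sum⇒positive-after X t lt
... | i , t≤i , pos = (λ j j≤t → positive-upTo {X} c1 c3 pos j (≤-trans j≤t t≤i))
                    , ≤-<-trans t≤i (at-positive⇒<length X i pos)

prefix<sum⇒≤prefix : ∀ {X} → C1 X → C3 X → ∀ t → prefix X t < sum X → t ≤ prefix X t
prefix<sum⇒≤prefix {X} c1 c3 t lt =
  prefix-+-positive X 0 t (λ j j<t → proj₁ (prefix<sum⇒positive {X} c1 c3 t lt) j (<⇒≤ j<t))

C4-window-reindex : ∀ X v →
  at X (3 + v) + at X (4 + v) + at X (5 + v) + at X (5 + (v + 1)) + at X (5 + (v + 2)) ≡ window X (3 + v)
C4-window-reindex X v =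
  cong₂ _+_ (cong (λ u → at X (3 + v) + at X (4 + v) + at X (5 + v) + at X (5 + u)) (+-comm v 1))
            (cong (λ u → at X (5 + u)) (+-comm v 2))

-- The window around index 0 loses its two entries at negative indices.
C4-from-windows : ∀ δ X → (0 < length X → δ* δ ≤ at X 0 + at X 1 + at X 2) →
  (∀ k → suc k * 5 < length X → δ* δ ≤ window X (3 + k * 5)) → C4 δ X
C4-from-windows δ X first _    i h (divides zero    refl) = first h
C4-from-windows δ X _    rest i h (divides (suc k) refl) =
  subst (δ* δ ≤_) (sym (C4-window-reindex X (k * 5))) (rest k h)

C4⇒window : ∀ {δ X} → C4 δ X → ∀ k → suc k * 5 < length X → δ* δ ≤ window X (3 + k * 5)
C4⇒window {δ} {X} c4 k h =
  subst (δ* δ ≤_) (C4-window-reindex X (k * 5)) (c4 (suc k * 5) h (divides (suc k) refl))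

prefix-window-bound : ∀ {δ X} → C4 δ X → ∀ k → k * 5 < length X → suc k * δ* δ ≤ prefix X (3 + k * 5)
prefix-window-bound {δ} {X} c4 zero h = begin
  δ* δ + 0                  ≡⟨ +-identityʳ (δ* δ) ⟩
  δ* δ                      ≤⟨ c4 0 h (divides 0 refl) ⟩
  at X 0 + at X 1 + at X 2  ≡⟨ sym prefix-3 ⟩
  prefix X 3                ∎
  where
  open ≤-Reasoning
  prefix-3 : prefix X 3 ≡ at X 0 + at X 1 + at X 2
  prefix-3 rewrite prefix-suc X 2 | prefix-suc X 1 | prefix-suc X 0 = refl
prefix-window-bound {δ} {X} c4 (suc k) h =
  ≤-trans (+-mono-≤ (C4⇒window {δ} {X} c4 k h)
                    (prefix-window-bound {δ} {X} c4 k (≤-<-trans (m≤n+m (k * 5) 5) h)))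
          (≤-reflexive (sym (prefix-+5 X (3 + k * 5))))

m*n≤o⇒m≤o/n : ∀ m n {o} .{{_ : NonZero n}} → m * n ≤ o → m ≤ o / n
m*n≤o⇒m≤o/n m n m*n≤o = subst (_≤ _ / n) (m*n/n≡m m n) (/-monoˡ-≤ n m*n≤o)

windows≤quotient : ∀ {n δ X} → Admissible n δ X → ∀ k → k * 5 < length X → suc k ≤ n / δ* δ
windows≤quotient {δ = δ} {X} (_ , c2 , _ , c4) k h = m*n≤o⇒m≤o/n (suc k) (δ* δ)
  (≤-trans (prefix-window-bound {δ} {X} c4 k h)
           (subst (prefix X (3 + k * 5) ≤_) c2 (prefix≤sum X (3 + k * 5))))

prefix-lower-bound : ∀ {n δ X} → Admissible n δ X → ∀ j r → prefix X (3 + (j * 5 + r)) < n →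
  suc j * δ* δ + r ≤ prefix X (3 + (j * 5 + r))
prefix-lower-bound {δ = δ} {X} (c1 , refl , c3 , c4) j r lt with prefix<sum⇒positive {X} c1 c3 _ lt
... | pos , t<len = ≤-trans (+-monoˡ-≤ r (prefix-window-bound {δ} {X} c4 j (≤-<-trans j*5≤t t<len)))
                            (prefix-+-positive X (3 + j * 5) r (λ i i<t → pos i (<⇒≤ i<t)))
  where
  j*5≤t : j * 5 ≤ 3 + (j * 5 + r)
  j*5≤t = ≤-trans (m≤m+n (j * 5) r) (m≤n+m _ 3)

δ*≥5 : ∀ {δ} → 3 ≤ δ → 5 ≤ δ* δ
δ*≥5 {δ} δ≥3 = s≤s (begin
  4                   ≡⟨ sym (m+n∸m≡n δ 4) ⟩
  δ + 4 ∸ δ           ≤⟨ ∸-mono δ+4≤δ*δ 2⌊δ/2⌋≤δ ⟩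
  δ * δ ∸ 2 * (δ / 2) ∎)
  where
  open ≤-Reasoning
  δ+4≤δ*δ : δ + 4 ≤ δ * δ
  δ+4≤δ*δ = ≤-trans (+-monoʳ-≤ δ (*-monoʳ-≤ 2 (≤-trans (n≤1+n 2) δ≥3))) (*-monoˡ-≤ δ δ≥3)
  2⌊δ/2⌋≤δ : 2 * (δ / 2) ≤ δ
  2⌊δ/2⌋≤δ = ≤-trans (≤-reflexive (*-comm 2 (δ / 2))) (m/n*n≤m δ 2)

+-∸-cancel : ∀ {a s} x → a ≤ s → a + ((s ∸ a) + x) ≡ s + x
+-∸-cancel {a} {s} x a≤s = trans (sym (+-assoc a (s ∸ a) x)) (cong (_+ x) (m+[n∸m]≡n a≤s))

blocks : ℕ → ℕ → Seq → Seq
blocks k s T = concat (replicate k (block s)) ++ T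

Zform : ℕ → ℕ → ℕ → Seq
Zform s m q = 1 ∷ 1 ∷ (s ∸ 2) ∷ blocks m s (tailZ q)

Z≡Zform : ∀ n δ → Z n δ ≡ Zform (δ* δ) (n / δ* δ ∸ 1) (n % δ* δ)
Z≡Zform n δ = refl

sum-blocks : ∀ {s} k T → 4 ≤ s → sum (blocks k s T) ≡ k * s + sum T
sum-blocks zero    T _   = refl
sum-blocks {s} (suc k) T s≥4 =
  trans (+-∸-cancel _ s≥4) (trans (cong (s +_) (sum-blocks k T s≥4)) (sym (+-assoc s (k * s) (sum T))))

sum-tailZ : ∀ q → sum (tailZ q) ≡ q
sum-tailZ zero          = refl
sum-tailZ (suc zero)    = refl
sum-tailZ (suc (suc k)) = cong (2 +_) (+-identityʳ k)

sum-Zform : ∀ {s} m q → 4 ≤ s → sum (Zform s m q) ≡ suc m * s + q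
sum-Zform {s} m q s≥4 = begin
  2 + ((s ∸ 2) + sum (blocks m s (tailZ q))) ≡⟨ +-∸-cancel _ (≤-trans (m≤n+m 2 2) s≥4) ⟩
  s + sum (blocks m s (tailZ q))             ≡⟨ cong (s +_) (sum-blocks m (tailZ q) s≥4) ⟩
  s + (m * s + sum (tailZ q))                ≡⟨ cong (λ x → s + (m * s + x)) (sum-tailZ q) ⟩
  s + (m * s + q)                            ≡⟨ sym (+-assoc s (m * s) q) ⟩
  suc m * s + q                              ∎
  where open ≡-Reasoning

Positive : Seq → Set
Positive X = ∀ u → u < length X → 1 ≤ at X u

Positive⇒C3 : ∀ X → Positive X → C3 X
Positive⇒C3 X pos i hi j _ j<i = pos j (<-trans j<i (at-positive⇒<length X i hi))

tailZ-positive : ∀ q → Positive (tailZ q)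
tailZ-positive (suc zero)    zero       _ = s≤s z≤n
tailZ-positive (suc (suc k)) zero       _ = s≤s z≤n
tailZ-positive (suc (suc k)) (suc zero) _ = s≤s z≤n
tailZ-positive (suc zero)    (suc u) (s≤s ())
tailZ-positive (suc (suc k)) (suc (suc u)) (s≤s (s≤s ()))

blocks-positive : ∀ {s} k T → 5 ≤ s → Positive T → Positive (blocks k s T)
blocks-positive zero    T _   posT u h = posT u h
blocks-positive (suc k) T _   _    0 _ = s≤s z≤n
blocks-positive (suc k) T _   _    1 _ = s≤s z≤n
blocks-positive (suc k) T _   _    2 _ = s≤s z≤n
blocks-positive (suc k) T _   _    3 _ = s≤s z≤n
blocks-positive (suc k) T s≥5 _    4 _ = ∸-monoˡ-≤ 4 s≥5
blocks-positive (suc k) T s≥5 posT (suc (suc (suc (suc (suc u))))) (s≤s (s≤s (s≤s (s≤s (s≤s h))))) =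
  blocks-positive k T s≥5 posT u h

Zform-positive : ∀ {s} m q → 5 ≤ s → Positive (Zform s m q)
Zform-positive m q _   0 _ = s≤s z≤n
Zform-positive m q _   1 _ = s≤s z≤n
Zform-positive m q s≥5 2 _ = ∸-monoˡ-≤ 2 (≤-trans (m≤n+m 3 2) s≥5)
Zform-positive m q s≥5 (suc (suc (suc u))) (s≤s (s≤s (s≤s h))) =
  blocks-positive m (tailZ q) s≥5 (tailZ-positive q) u h

length-blocks : ∀ {s} k T → length (blocks k s T) ≡ k * 5 + length T
length-blocks zero    T = refl
length-blocks {s} (suc k) T = cong (5 +_) (length-blocks {s} k T)

length-tailZ : ∀ q → length (tailZ q) ≤ 2
length-tailZ zero          = z≤n
length-tailZ (suc zero)    = s≤s z≤n
length-tailZ (suc (suc k)) = ≤-refl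

window-blocks : ∀ {s} k T → 4 ≤ s → ∀ j → j < k → window (blocks k s T) (j * 5) ≡ s
window-blocks (suc k) T s≥4 zero    _       = m+[n∸m]≡n s≥4
window-blocks {s} (suc k) T s≥4 (suc j) (s≤s h) = window-blocks {s} k T s≥4 j h

C4-Zform : ∀ δ m q → 5 ≤ δ* δ → C4 δ (Zform (δ* δ) m q)
C4-Zform δ m q s≥5 = C4-from-windows δ (Zform (δ* δ) m q)
  (λ _ → ≤-reflexive (sym (m+[n∸m]≡n (≤-trans (m≤n+m 2 3) s≥5))))
  (λ k h → ≤-reflexive (sym (window-blocks {δ* δ} m (tailZ q) (≤-trans (n≤1+n 4) s≥5) k (k<m k h))))
  where
  k<m : ∀ k → suc k * 5 < length (Zform (δ* δ) m q) → k < m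
  k<m k h = *-cancelʳ-< 5 k m (+-cancelˡ-< 5 (k * 5) (m * 5) (begin-strict
    5 + k * 5                               <⟨ h ⟩
    3 + length (blocks m (δ* δ) (tailZ q))  ≡⟨ cong (3 +_) (length-blocks {δ* δ} m (tailZ q)) ⟩
    3 + (m * 5 + length (tailZ q))          ≤⟨ +-monoʳ-≤ 3 (+-monoʳ-≤ (m * 5) (length-tailZ q)) ⟩
    3 + (m * 5 + 2)                         ≡⟨ cong (3 +_) (+-comm (m * 5) 2) ⟩
    5 + m * 5                               ∎))
    where open ≤-Reasoning

prefix-blocks-inner : ∀ {s} k T → 4 ≤ s → ∀ j r → j < k → r < 5 →
  prefix (blocks k s T) (j * 5 + r) ≡ j * s + r
prefix-blocks-inner (suc k) T _ zero 0 _ _ = refl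
prefix-blocks-inner (suc k) T _ zero 1 _ _ = refl
prefix-blocks-inner (suc k) T _ zero 2 _ _ = refl
prefix-blocks-inner (suc k) T _ zero 3 _ _ = refl
prefix-blocks-inner (suc k) T _ zero 4 _ _ = refl
prefix-blocks-inner (suc k) T _ zero (suc (suc (suc (suc (suc r))))) _ (s≤s (s≤s (s≤s (s≤s (s≤s ())))))
prefix-blocks-inner {s} (suc k) T s≥4 (suc j) r (s≤s j<k) r<5 =
  trans (+-∸-cancel _ s≥4)
        (trans (cong (s +_) (prefix-blocks-inner k T s≥4 j r j<k r<5)) (sym (+-assoc s (j * s) r)))

prefix-blocks-last : ∀ {s} k T → 4 ≤ s → ∀ r → prefix (blocks k s T) (k * 5 + r) ≡ k * s + prefix T r
prefix-blocks-last zero        T _   r = refl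
prefix-blocks-last {s} (suc k) T s≥4 r =
  trans (+-∸-cancel _ s≥4)
        (trans (cong (s +_) (prefix-blocks-last k T s≥4 r)) (sym (+-assoc s (k * s) (prefix T r))))

prefix-tailZ≤ : ∀ q r → r ≤ 1 → prefix (tailZ q) r ≤ r
prefix-tailZ≤ q             zero       _ = z≤n
prefix-tailZ≤ zero          (suc zero) _ = z≤n
prefix-tailZ≤ (suc zero)    (suc zero) _ = ≤-refl
prefix-tailZ≤ (suc (suc k)) (suc zero) _ = ≤-refl
prefix-tailZ≤ q             (suc (suc r)) (s≤s ())

prefix-Zform : ∀ {s} m q → 2 ≤ s → ∀ u →
  prefix (Zform s m q) (3 + u) ≡ s + prefix (blocks m s (tailZ q)) u
prefix-Zform m q s≥2 u = +-∸-cancel _ s≥2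

quotient≡suc-pred : ∀ {n s} .{{_ : NonZero s}} → s ≤ n → suc (n / s ∸ 1) ≡ n / s
quotient≡suc-pred {n} {s} s≤n =
  m+[n∸m]≡n (m*n≤o⇒m≤o/n 1 s (subst (_≤ n) (sym (+-identityʳ s)) s≤n))

sum-Z : ∀ {n δ} → 3 ≤ δ → δ* δ ≤ n → sum (Z n δ) ≡ n
sum-Z {n} {δ} δ≥3 s≤n = begin
  sum (Z n δ)                ≡⟨ cong sum (Z≡Zform n δ) ⟩
  sum (Zform s (p ∸ 1) q)    ≡⟨ sum-Zform (p ∸ 1) q (≤-trans (n≤1+n 4) (δ*≥5 δ≥3)) ⟩
  suc (p ∸ 1) * s + q        ≡⟨ cong (λ x → x * s + q) (quotient≡suc-pred s≤n) ⟩
  p * s + q                  ≡⟨ +-comm (p * s) q ⟩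
  q + p * s                  ≡⟨ sym (m≡m%n+[m/n]*n n s) ⟩
  n                          ∎
  where
  open ≡-Reasoning
  s p q : ℕ
  s = δ* δ
  p = n / s
  q = n % s

Z-admissible : ∀ {n δ} → 3 ≤ δ → δ* δ ≤ n → Admissible n δ (Z n δ)
Z-admissible {n} {δ} δ≥3 s≤n =
  refl
  , sum-Z δ≥3 s≤n
  , Positive⇒C3 (Z n δ) (Zform-positive (n / δ* δ ∸ 1) (n % δ* δ) (δ*≥5 δ≥3))
  , C4-Zform δ (n / δ* δ ∸ 1) (n % δ* δ) (δ*≥5 δ≥3)

prefix-Z≤prefix-window : ∀ {n δ X} → 3 ≤ δ → δ* δ ≤ n → Admissible n δ X → ∀ j r → r < 5 →
  prefix X (3 + (j * 5 + r)) < n → prefix (Z n δ) (3 + (j * 5 + r)) ≤ prefix X (3 + (j * 5 + r))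
prefix-Z≤prefix-window {n} {δ} {X} δ≥3 s≤n adm@(c1 , refl , c3 , _) j r r<5 lt =
  by-block (m≤n⇒m<n∨m≡n j≤m)
  where
  s m q : ℕ
  s = δ* δ
  m = n / s ∸ 1
  q = n % s
  s≥4 : 4 ≤ s
  s≥4 = ≤-trans (n≤1+n 4) (δ*≥5 δ≥3)
  s≥2 : 2 ≤ s
  s≥2 = ≤-trans (m≤n+m 2 2) s≥4
  t<len : 3 + (j * 5 + r) < length X
  t<len = proj₂ (prefix<sum⇒positive {X} c1 c3 _ lt)
  windows≤m : ∀ k → k * 5 < length X → k ≤ m
  windows≤m k h =
    ≤-pred (subst (suc k ≤_) (sym (quotient≡suc-pred s≤n)) (windows≤quotient {n} {δ} {X} adm k h))
  j≤m : j ≤ m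
  j≤m = windows≤m j (≤-<-trans (≤-trans (m≤m+n (j * 5) r) (m≤n+m _ 3)) t<len)
  lower : suc j * s + r ≤ prefix X (3 + (j * 5 + r))
  lower = prefix-lower-bound {n} {δ} {X} adm j r lt
  open ≤-Reasoning
  by-block : j < m ⊎ j ≡ m → prefix (Z n δ) (3 + (j * 5 + r)) ≤ prefix X (3 + (j * 5 + r))
  by-block (inj₁ j<m) = begin
    prefix (Z n δ) (3 + (j * 5 + r))
      ≡⟨ prefix-Zform m q s≥2 (j * 5 + r) ⟩
    s + prefix (blocks m s (tailZ q)) (j * 5 + r)
      ≡⟨ cong (s +_) (prefix-blocks-inner m (tailZ q) s≥4 j r j<m r<5) ⟩
    s + (j * s + r)
      ≡⟨ sym (+-assoc s (j * s) r) ⟩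
    suc j * s + r
      ≤⟨ lower ⟩
    prefix X (3 + (j * 5 + r)) ∎
  by-block (inj₂ refl) with r ≤? 1
  ... | yes r≤1 = begin
    prefix (Z n δ) (3 + (m * 5 + r))
      ≡⟨ prefix-Zform m q s≥2 (m * 5 + r) ⟩
    s + prefix (blocks m s (tailZ q)) (m * 5 + r)
      ≡⟨ cong (s +_) (prefix-blocks-last m (tailZ q) s≥4 r) ⟩
    s + (m * s + prefix (tailZ q) r)
      ≤⟨ +-monoʳ-≤ s (+-monoʳ-≤ (m * s) (prefix-tailZ≤ q r r≤1)) ⟩
    s + (m * s + r)
      ≡⟨ sym (+-assoc s (m * s) r) ⟩
    suc m * s + r
      ≤⟨ lower ⟩
    prefix X (3 + (m * 5 + r)) ∎
  -- For r ≥ 2 the window centred at 5(m+1) fits into X, which would force n ≥ (m+2)·δ*.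
  ... | no r≰1 = contradiction (windows≤m (suc m) (≤-<-trans next-window≤t t<len)) 1+n≰n
    where
    next-window≤t : suc m * 5 ≤ 3 + (m * 5 + r)
    next-window≤t =
      +-monoʳ-≤ 3 (≤-trans (≤-reflexive (+-comm 2 (m * 5))) (+-monoʳ-≤ (m * 5) (≰⇒> r≰1)))

prefix-Z-minimal : ∀ {n δ X} → 3 ≤ δ → δ* δ ≤ n → Admissible n δ X →
  ∀ t → prefix (Z n δ) t ≤ prefix X t
prefix-Z-minimal {n} {δ} {X} δ≥3 s≤n adm@(c1 , refl , c3 , _) t with prefix X t <? n
... | no  t-full = begin
  prefix (Z n δ) t ≤⟨ prefix≤sum (Z n δ) t ⟩
  sum (Z n δ)      ≡⟨ sum-Z δ≥3 s≤n ⟩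
  n                ≤⟨ ≮⇒≥ t-full ⟩
  prefix X t       ∎
  where open ≤-Reasoning
... | yes lt = partial t lt
  where
  partial : ∀ t → prefix X t < n → prefix (Z n δ) t ≤ prefix X t
  partial 0 _  = z≤n
  partial 1 lt = prefix<sum⇒≤prefix {X} c1 c3 1 lt
  partial 2 lt = prefix<sum⇒≤prefix {X} c1 c3 2 lt
  partial (suc (suc (suc u))) =
    subst (λ u → prefix X (3 + u) < n → prefix (Z n δ) (3 + u) ≤ prefix X (3 + u))
      (sym (trans (m≡m%n+[m/n]*n u 5) (+-comm (u % 5) _)))
      (prefix-Z≤prefix-window δ≥3 s≤n adm (u / 5) (u % 5) (m%n<n u 5))

lemma5p4 : (n δ : ℕ) → 3 ≤ δ → n ≥ 2 * δ* δ → (X : Seq) → Admissible n δ X →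
    (∀ (X′ : Seq) → Admissible n δ X′ → g X ≥ g X′) →
    ∀ i → at X i ≡ at (Z n δ) i
lemma5p4 n δ δ≥3 n≥2δ* X adm@(_ , sumX≡n , _) optimal =
  prefix-≤-g-≤⇒at-≡ X (Z n δ) (trans (sum-Z δ≥3 δ*≤n) (sym sumX≡n))
    (prefix-Z-minimal δ≥3 δ*≤n adm) (optimal (Z n δ) (Z-admissible δ≥3 δ*≤n))
  where
  δ*≤n : δ* δ ≤ n
  δ*≤n = ≤-trans (m≤m+n (δ* δ) _) n≥2δ*
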